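{- Let $X,Y$ be indeterminates and let $L^{(2)}_n(x;X,Y)$ be the monic polynomials defined by $L^{(2)}_{ -1}=0$, $L^{(2)}_0=1$ and $L^{(2)}_{n+1}=(x-b_n)L^{(2)}_n-\lambda_nL^{(2)}_{n-1}$ for $n\ge0$, where $b_0=X$, $b_n=2n+X+Y-1$ for $n>0$, and $\lambda_n=(n-1+X)(n-1+Y)$. Then for every non-negative integer $n$, \[ L^{(2)}_n(x;X,Y)=\sum_{k=0}^n (X+k)_{n-k}\binom{n}{k}\, {}_3F_2\!\left(\begin{matrix}k-n,\ k,\ Y-1\\ -n,\ X+k\end{matrix};1\right)(-1)^{n-k}x^k . \]
   Context: $(a)_m=a(a+1)\cdots(a+m-1)$ with $(a)_0=1$. ${}_3F_2\!\left(\begin{matrix}a_1,a_2,a_3\\ b_1,b_2\end{matrix};z\right)=\sum_{j\ge0}\frac{(a_1)_j(a_2)_j(a_3)_j}{(b_1)_j(b_2)_j\,j!}z^j$; here the series terminates at $j=n-k$ because of the numerator parameter $k-n$. -}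

module Defs where

open import Data.Nat as ℕ using (ℕ; zero; suc; _∸_)
open import Data.Nat.Combinatorics using (_C_)
open import Data.Rational using (ℚ; 0ℚ; 1ℚ; _+_; _*_; _-_; -_; 1/_; ≢-nonZero)
open import Data.Rational.Properties using (_≟_)
open import Data.Integer using (+_)
open import Data.Rational using (_/_)
open import Relation.Nullary using (yes; no)

ι : ℕ → ℚ
ι n = + n / 1

Σ0to : ℕ → (ℕ → ℚ) → ℚ
Σ0to zero    f = f 0
Σ0to (suc N) f = Σ0to N f + f (suc N)

_^_ : ℚ → ℕ → ℚ
q ^ zero  = 1ℚ
q ^ suc m = q * (q ^ m)

poch : ℚ → ℕ → ℚ
poch a zero    = 1ℚ
poch a (suc m) = poch a m * (a + ι m)

-- reciprocal, total by the convention inv 0 = 0; only ever applied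
-- (under the theorem's hypotheses) to nonzero numbers
inv : ℚ → ℚ
inv q with q ≟ 0ℚ
... | yes _  = 0ℚ
... | no q≢0 = 1/_ q {{≢-nonZero q≢0}}

F32 : ℚ → ℚ → ℚ → ℚ → ℚ → ℚ → ℕ → ℚ
F32 a₁ a₂ a₃ b₁ b₂ z N =
  Σ0to N (λ j → poch a₁ j * poch a₂ j * poch a₃ j
                 * inv (poch b₁ j * poch b₂ j * ι (j ℕ.!)) * (z ^ j))

bcoef : ℚ → ℚ → ℕ → ℚ
bcoef X Y zero    = X
bcoef X Y (suc n) = ι (2 ℕ.* suc n) + X + Y - 1ℚ

λcoef : ℚ → ℚ → ℕ → ℚ
λcoef X Y n = (ι n - 1ℚ + X) * (ι n - 1ℚ + Y)

L2 : ℕ → ℚ → ℚ → ℚ → ℚ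
L2 zero          x X Y = 1ℚ
L2 (suc zero)    x X Y = (x - bcoef X Y 0) * 1ℚ - λcoef X Y 0 * 0ℚ
L2 (suc (suc n)) x X Y =
  (x - bcoef X Y (suc n)) * L2 (suc n) x X Y - λcoef X Y (suc n) * L2 n x X Y

RHS : ℕ → ℚ → ℚ → ℚ → ℚ
RHS n x X Y =
  Σ0to n (λ k → poch (X + ι k) (n ∸ k) * ι (n C k)
     * F32 (ι k - ι n) (ι k) (Y - 1ℚ) (- ι n) (X + ι k) 1ℚ (n ∸ k)
     * ((- 1ℚ) ^ (n ∸ k)) * (x ^ k))

{-# OPTIONS --safe #-}
-- Let Pₙ(t) = (-1)ⁿ L⁽²⁾ₙ(-t); then P₀ = 1, P₁ = t + X and Pₙ₊₂ = (t + bₙ₊₁) Pₙ₊₁ - λₙ₊₁ Pₙ.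
-- With lag m k a = C(m,k) (a+k)ₘ₋ₖ, the coefficient of tᵏ in m! L⁽ᵃ⁻¹⁾ₘ(-t), the coefficient of
-- tᵏ in Pₙ is the convolution
--   coeff n k = Σⱼ C(k+j-1,j) (Y-1)ⱼ lag (n-j) k (X+j).
-- Two contiguous relations of lag (Pascal's rule in (m,k), and the step a ↦ a+1) show that each
-- summand obeys the recurrence of Pₙ up to a difference defectⱼ - defectⱼ₊₁, which telescopes
-- away, so coeff satisfies the recurrence coefficientwise. Finally, for n = k + j + r the
-- identities C(n,k) (k-n)ⱼ = C(k+r,k) (-n)ⱼ, (k)ⱼ = j! C(k+j-1,j) and (X+k)ₙ₋ₖ = (X+k)ⱼ (X+k+j)ᵣ
-- turn the j-th term of (X+k)ₙ₋ₖ C(n,k) ₃F₂(…) into the j-th summand of coeff n k once the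
-- denominator (-n)ⱼ (X+k)ⱼ j! cancels; it is nonzero because X + i ≠ 0 for i < n.
module Submission where

open import Defs
open import Data.Empty using (⊥-elim)
import Data.Integer as ℤ
import Data.Integer.Properties as ℤ
open import Data.Nat as ℕ using (ℕ; zero; suc; _∸_; _!; _≤_; _<_; z≤n; s≤s)
import Data.Nat.Coprimality as Coprime
open import Data.Nat.Combinatorics
  using (_C_; nC1≡n; nCn≡1; nCk≡nC[n∸k]; nCk+nC[k+1]≡[n+1]C[k+1]; k>n⇒nCk≡0)
import Data.Nat.Properties as ℕ
import Data.Nat.Tactic.RingSolver as ℕ-Solver
open import Data.Rational using (ℚ; 0ℚ; 1ℚ; _+_; _*_; _-_; -_; 1/_; mkℚ; ↥_; ≢-nonZero)
open import Data.Rational.Properties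
  using (+-*-commutativeRing; _≟_; /-cong; normalize-coprime; *-inverseˡ; *-inverseʳ; *-zeroˡ; *-zeroʳ;
        *-identityˡ; *-identityʳ; *-assoc; *-distribˡ-+; +-assoc; +-identityˡ; +-identityʳ; +-inverseʳ)
open import Level using (0ℓ)
open import Relation.Binary.PropositionalEquality
open import Relation.Nullary using (yes; no)
open import Relation.Nullary.Decidable.Core using (dec⇒maybe)
open import Tactic.RingSolver using (solve-∀)
import Tactic.RingSolver.Core.AlmostCommutativeRing as ACR

open ≡-Reasoning

-- The zero test lets the solver cancel terms such as - a + a.
ℚ-ring : ACR.AlmostCommutativeRing 0ℓ 0ℓ
ℚ-ring = ACR.fromCommutativeRing +-*-commutativeRing (λ q → dec⇒maybe (0ℚ ≟ q))

x+c*0≡x : ∀ x c → x + c * 0ℚ ≡ x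
x+c*0≡x = solve-∀ ℚ-ring

x-c*0≡x : ∀ x c → x - c * 0ℚ ≡ x
x-c*0≡x = solve-∀ ℚ-ring

C-absorption : ∀ n k → suc k ℕ.* (suc n C suc k) ≡ suc n ℕ.* (n C k)
C-absorption n       zero    = trans (ℕ.+-identityʳ _) (trans (nC1≡n (suc n)) (sym (ℕ.*-identityʳ (suc n))))
C-absorption zero    (suc k) = ℕ.*-zeroʳ (suc (suc k))
C-absorption (suc n) (suc k) = begin
  suc (suc k) ℕ.* (suc (suc n) C suc (suc k))
    ≡⟨ cong (suc (suc k) ℕ.*_) (sym (nCk+nC[k+1]≡[n+1]C[k+1] (suc n) (suc k))) ⟩
  suc (suc k) ℕ.* (suc n C suc k ℕ.+ suc n C suc (suc k))
    ≡⟨ regroup (suc n C suc k) (suc n C suc (suc k)) k ⟩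
  suc n C suc k ℕ.+ (suc k ℕ.* (suc n C suc k) ℕ.+ suc (suc k) ℕ.* (suc n C suc (suc k)))
    ≡⟨ cong₂ (λ p q → suc n C suc k ℕ.+ (p ℕ.+ q)) (C-absorption n k) (C-absorption n (suc k)) ⟩
  suc n C suc k ℕ.+ (suc n ℕ.* (n C k) ℕ.+ suc n ℕ.* (n C suc k))
    ≡⟨ cong (suc n C suc k ℕ.+_) (sym (ℕ.*-distribˡ-+ (suc n) (n C k) (n C suc k))) ⟩
  suc n C suc k ℕ.+ suc n ℕ.* (n C k ℕ.+ n C suc k)
    ≡⟨ cong (λ c → suc n C suc k ℕ.+ suc n ℕ.* c) (nCk+nC[k+1]≡[n+1]C[k+1] n k) ⟩
  suc (suc n) ℕ.* (suc n C suc k) ∎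
  where
  regroup : ∀ a b k → suc (suc k) ℕ.* (a ℕ.+ b) ≡ a ℕ.+ (suc k ℕ.* a ℕ.+ suc (suc k) ℕ.* b)
  regroup = ℕ-Solver.solve-∀

C-sym : ∀ a b → (a ℕ.+ b) C b ≡ (a ℕ.+ b) C a
C-sym a b = trans (nCk≡nC[n∸k] (ℕ.m≤n+m b a)) (cong ((a ℕ.+ b) C_) (ℕ.m+n∸n≡m a b))

C-absorption-complement : ∀ k r → suc r ℕ.* (suc (k ℕ.+ r) C k) ≡ suc (k ℕ.+ r) ℕ.* ((k ℕ.+ r) C k)
C-absorption-complement k r = begin
  suc r ℕ.* (suc (k ℕ.+ r) C k)          ≡⟨ cong (λ m → suc r ℕ.* (m C k)) (sym (ℕ.+-suc k r)) ⟩
  suc r ℕ.* ((k ℕ.+ suc r) C k)          ≡⟨ cong (suc r ℕ.*_) (sym (C-sym k (suc r))) ⟩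
  suc r ℕ.* ((k ℕ.+ suc r) C suc r)      ≡⟨ cong (λ m → suc r ℕ.* (m C suc r)) (ℕ.+-suc k r) ⟩
  suc r ℕ.* (suc (k ℕ.+ r) C suc r)      ≡⟨ C-absorption (k ℕ.+ r) r ⟩
  suc (k ℕ.+ r) ℕ.* ((k ℕ.+ r) C r)      ≡⟨ cong (suc (k ℕ.+ r) ℕ.*_) (C-sym k r) ⟩
  suc (k ℕ.+ r) ℕ.* ((k ℕ.+ r) C k) ∎

-- The number of j-element multisets from k elements; truncated subtraction still gives
-- multichoose 0 0 = 1.
multichoose : ℕ → ℕ → ℕ
multichoose k j = (k ℕ.+ j ∸ 1) C j

multichoose-zeroˡ : ∀ j → multichoose 0 (suc j) ≡ 0
multichoose-zeroˡ j = k>n⇒nCk≡0 (ℕ.n<1+n j)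

multichoose-pascal : ∀ k j → multichoose (suc k) (suc j) ≡ multichoose k (suc j) ℕ.+ multichoose (suc k) j
multichoose-pascal k j = begin
  (k ℕ.+ suc j) C suc j                          ≡⟨ cong (_C suc j) (ℕ.+-suc k j) ⟩
  suc (k ℕ.+ j) C suc j                          ≡⟨ sym (nCk+nC[k+1]≡[n+1]C[k+1] (k ℕ.+ j) j) ⟩
  (k ℕ.+ j) C j ℕ.+ (k ℕ.+ j) C suc j            ≡⟨ ℕ.+-comm ((k ℕ.+ j) C j) _ ⟩
  (k ℕ.+ j) C suc j ℕ.+ (k ℕ.+ j) C j            ≡⟨ cong (λ m → (m ∸ 1) C suc j ℕ.+ (k ℕ.+ j) C j) (sym (ℕ.+-suc k j)) ⟩
  multichoose k (suc j) ℕ.+ multichoose (suc k) j ∎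

multichoose-absorption : ∀ k j → suc j ℕ.* multichoose k (suc j) ≡ (k ℕ.+ j) ℕ.* multichoose k j
multichoose-absorption zero zero          = refl
multichoose-absorption zero (suc j)       = begin
  suc (suc j) ℕ.* multichoose 0 (suc (suc j)) ≡⟨ cong (suc (suc j) ℕ.*_) (multichoose-zeroˡ (suc j)) ⟩
  suc (suc j) ℕ.* 0                           ≡⟨ ℕ.*-zeroʳ (suc (suc j)) ⟩
  0                                           ≡⟨ sym (ℕ.*-zeroʳ (suc j)) ⟩
  suc j ℕ.* 0                                 ≡⟨ cong (suc j ℕ.*_) (multichoose-zeroˡ j) ⟨
  suc j ℕ.* multichoose 0 (suc j)             ∎
multichoose-absorption (suc k) j = begin
  suc j ℕ.* ((k ℕ.+ suc j) C suc j)   ≡⟨ cong (λ m → suc j ℕ.* (m C suc j)) (ℕ.+-suc k j) ⟩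
  suc j ℕ.* (suc (k ℕ.+ j) C suc j)   ≡⟨ C-absorption (k ℕ.+ j) j ⟩
  suc (k ℕ.+ j) ℕ.* ((k ℕ.+ j) C j)   ∎

ι-mkℚ : ∀ n → ι n ≡ mkℚ (ℤ.+ n) 0 (Coprime.sym (Coprime.1-coprimeTo n))
ι-mkℚ n = normalize-coprime (Coprime.sym (Coprime.1-coprimeTo n))

ι-+ : ∀ m n → ι (m ℕ.+ n) ≡ ι m + ι n
ι-+ m n = sym (begin
  ι m + ι n   ≡⟨ cong₂ _+_ (ι-mkℚ m) (ι-mkℚ n) ⟩
  _           ≡⟨ /-cong {p₁ = ℤ.+ m ℤ.* ℤ.+ 1 ℤ.+ ℤ.+ n ℤ.* ℤ.+ 1} {q₁ = 1}
                        (cong₂ ℤ._+_ (ℤ.*-identityʳ (ℤ.+ m)) (ℤ.*-identityʳ (ℤ.+ n))) refl ⟩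
  ι (m ℕ.+ n) ∎)

ι-* : ∀ m n → ι (m ℕ.* n) ≡ ι m * ι n
ι-* m n = sym (begin
  ι m * ι n   ≡⟨ cong₂ _*_ (ι-mkℚ m) (ι-mkℚ n) ⟩
  _           ≡⟨ /-cong {p₁ = ℤ.+ m ℤ.* ℤ.+ n} {q₁ = 1} (sym (ℤ.pos-* m n)) refl ⟩
  ι (m ℕ.* n) ∎)

ι-suc : ∀ n → ι (suc n) ≡ 1ℚ + ι n
ι-suc = ι-+ 1

ι-injective : ∀ {m n} → ι m ≡ ι n → m ≡ n
ι-injective {m} {n} eq = ℤ.+-injective (cong ↥_ (trans (sym (ι-mkℚ m)) (trans eq (ι-mkℚ n))))

ι-≢0 : ∀ {n} → n ≢ 0 → ι n ≢ 0ℚ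
ι-≢0 n≢0 ιn≡0 = n≢0 (ι-injective ιn≡0)

ι[1+m]-ι[1+j]≡ι[m]-ι[j] : ∀ m j → ι (suc m) - ι (suc j) ≡ ι m - ι j
ι[1+m]-ι[1+j]≡ι[m]-ι[j] m j = trans (cong₂ _-_ (ι-suc m) (ι-suc j)) (cancel (ι m) (ι j))
  where
  cancel : ∀ m j → 1ℚ + m - (1ℚ + j) ≡ m - j
  cancel = solve-∀ ℚ-ring

ι-C-absorption-complement : ∀ k r → ι (suc r) * ι (suc (k ℕ.+ r) C k) ≡ ι (suc (k ℕ.+ r)) * ι ((k ℕ.+ r) C k)
ι-C-absorption-complement k r = begin
  ι (suc r) * ι (suc (k ℕ.+ r) C k)          ≡⟨ sym (ι-* (suc r) (suc (k ℕ.+ r) C k)) ⟩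
  ι (suc r ℕ.* (suc (k ℕ.+ r) C k))          ≡⟨ cong ι (C-absorption-complement k r) ⟩
  ι (suc (k ℕ.+ r) ℕ.* ((k ℕ.+ r) C k))      ≡⟨ ι-* (suc (k ℕ.+ r)) ((k ℕ.+ r) C k) ⟩
  ι (suc (k ℕ.+ r)) * ι ((k ℕ.+ r) C k)      ∎

*-invʳ : ∀ {p} → p ≢ 0ℚ → p * inv p ≡ 1ℚ
*-invʳ {p} p≢0 with p ≟ 0ℚ
... | yes p≡0 = ⊥-elim (p≢0 p≡0)
... | no  p≢0′ = *-inverseʳ p {{≢-nonZero p≢0′}}

*-inv-cancel : ∀ {p} q → p ≢ 0ℚ → p * q * inv p ≡ q
*-inv-cancel {p} q p≢0 = begin
  p * q * inv p   ≡⟨ regroup p q (inv p) ⟩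
  p * inv p * q   ≡⟨ cong (_* q) (*-invʳ p≢0) ⟩
  1ℚ * q          ≡⟨ *-identityˡ q ⟩
  q               ∎
  where
  regroup : ∀ p q i → p * q * i ≡ p * i * q
  regroup = solve-∀ ℚ-ring

*-≢0 : ∀ {p q} → p ≢ 0ℚ → q ≢ 0ℚ → p * q ≢ 0ℚ
*-≢0 {p} {q} p≢0 q≢0 pq≡0 = q≢0 (begin
  q               ≡⟨ sym (*-identityˡ q) ⟩
  1ℚ * q          ≡⟨ cong (_* q) (sym (*-inverseˡ p)) ⟩
  1/ p * p * q    ≡⟨ *-assoc (1/ p) p q ⟩
  1/ p * (p * q)  ≡⟨ cong (1/ p *_) pq≡0 ⟩
  1/ p * 0ℚ       ≡⟨ *-zeroʳ (1/ p) ⟩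
  0ℚ              ∎)
  where instance _ = ≢-nonZero p≢0

poch-+ : ∀ a j r → poch a (j ℕ.+ r) ≡ poch a j * poch (a + ι j) r
poch-+ a j zero    = trans (cong (poch a) (ℕ.+-identityʳ j)) (sym (*-identityʳ _))
poch-+ a j (suc r) = begin
  poch a (j ℕ.+ suc r)                              ≡⟨ cong (poch a) (ℕ.+-suc j r) ⟩
  poch a (j ℕ.+ r) * (a + ι (j ℕ.+ r))              ≡⟨ cong₂ _*_ (poch-+ a j r) (cong (a +_) (ι-+ j r)) ⟩
  poch a j * poch (a + ι j) r * (a + (ι j + ι r))  ≡⟨ assoc (poch a j) (poch (a + ι j) r) a (ι j) (ι r) ⟩
  poch a j * (poch (a + ι j) r * (a + ι j + ι r))  ∎
  where
  assoc : ∀ p q a b c → p * q * (a + (b + c)) ≡ p * (q * (a + b + c))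
  assoc = solve-∀ ℚ-ring

poch-suc : ∀ a r → poch a (suc r) ≡ a * poch (a + 1ℚ) r
poch-suc a r = trans (poch-+ a 1 r) (cong (_* poch (a + 1ℚ) r) (unit a))
  where
  unit : ∀ a → 1ℚ * (a + 0ℚ) ≡ a
  unit = solve-∀ ℚ-ring

poch-≢0 : ∀ a j → (∀ i → i < j → a + ι i ≢ 0ℚ) → poch a j ≢ 0ℚ
poch-≢0 a zero    _      ()
poch-≢0 a (suc j) factors≢0 =
  *-≢0 (poch-≢0 a j (λ i i<j → factors≢0 i (ℕ.m<n⇒m<1+n i<j))) (factors≢0 j ℕ.≤-refl)

poch[-n]≢0 : ∀ {n} j → j ≤ n → poch (- ι n) j ≢ 0ℚ
poch[-n]≢0 {n} j j≤n = poch-≢0 (- ι n) j (λ i i<j -n+i≡0 → ℕ.<-irrefl (ι-injective (begin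
  ι i                ≡⟨ shift-back (ι n) (ι i) ⟩
  - ι n + ι i + ι n  ≡⟨ cong (_+ ι n) -n+i≡0 ⟩
  0ℚ + ι n           ≡⟨ +-identityˡ (ι n) ⟩
  ι n                ∎)) (ℕ.<-≤-trans i<j j≤n))
  where
  shift-back : ∀ n i → i ≡ - n + i + n
  shift-back = solve-∀ ℚ-ring

poch-ι : ∀ k j → poch (ι k) j ≡ ι (multichoose k j ℕ.* j !)
poch-ι k zero    = refl
poch-ι k (suc j) = begin
  poch (ι k) j * (ι k + ι j)                      ≡⟨ cong₂ _*_ (poch-ι k j) (sym (ι-+ k j)) ⟩
  ι (multichoose k j ℕ.* j !) * ι (k ℕ.+ j)        ≡⟨ sym (ι-* (multichoose k j ℕ.* j !) (k ℕ.+ j)) ⟩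
  ι (multichoose k j ℕ.* j ! ℕ.* (k ℕ.+ j))        ≡⟨ cong ι (counted (multichoose k j) (j !) (k ℕ.+ j)) ⟩
  ι ((k ℕ.+ j) ℕ.* multichoose k j ℕ.* j !)        ≡⟨ cong (λ m → ι (m ℕ.* j !)) (sym (multichoose-absorption k j)) ⟩
  ι (suc j ℕ.* multichoose k (suc j) ℕ.* j !)      ≡⟨ cong ι (counted′ (suc j) (multichoose k (suc j)) (j !)) ⟩
  ι (multichoose k (suc j) ℕ.* suc j !)            ∎
  where
  counted : ∀ m f s → m ℕ.* f ℕ.* s ≡ s ℕ.* m ℕ.* f
  counted = ℕ-Solver.solve-∀
  counted′ : ∀ s m f → s ℕ.* m ℕ.* f ≡ m ℕ.* (s ℕ.* f)
  counted′ = ℕ-Solver.solve-∀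

ι[nCk]*poch[k-n]≡ι[[k+r]Ck]*poch[-n] : ∀ {n} k j r → k ℕ.+ j ℕ.+ r ≡ n →
  ι (n C k) * poch (ι k - ι n) j ≡ ι ((k ℕ.+ r) C k) * poch (- ι n) j
ι[nCk]*poch[k-n]≡ι[[k+r]Ck]*poch[-n] k zero r refl = cong (λ m → ι ((m ℕ.+ r) C k) * 1ℚ) (ℕ.+-identityʳ k)
ι[nCk]*poch[k-n]≡ι[[k+r]Ck]*poch[-n] {n} k (suc j) r k+[1+j]+r≡n = begin
  ι (n C k) * (poch (ι k - ι n) j * (ι k - ι n + ι j))
    ≡⟨ *-assoc (ι (n C k)) (poch (ι k - ι n) j) _ ⟨
  ι (n C k) * poch (ι k - ι n) j * (ι k - ι n + ι j)
    ≡⟨ cong (_* (ι k - ι n + ι j)) (ι[nCk]*poch[k-n]≡ι[[k+r]Ck]*poch[-n] k j (suc r) k+j+[1+r]≡n) ⟩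
  ι ((k ℕ.+ suc r) C k) * P * (ι k - ι n + ι j)
    ≡⟨ cong₂ (λ m ν → ι (m C k) * P * (ι k - ν + ι j)) (ℕ.+-suc k r) ν≡k+[1+r]+j ⟩
  ι (suc (k ℕ.+ r) C k) * P * (ι k - (ι k + ι (suc r) + ι j) + ι j)
    ≡⟨ collapse (ι (suc (k ℕ.+ r) C k)) P (ι k) (ι (suc r)) (ι j) ⟩
  - (ι (suc r) * ι (suc (k ℕ.+ r) C k) * P)
    ≡⟨ cong (λ c → - (c * P)) (ι-C-absorption-complement k r) ⟩
  - (ι (suc (k ℕ.+ r)) * ι ((k ℕ.+ r) C k) * P)
    ≡⟨ cong (λ m → - (m * ι ((k ℕ.+ r) C k) * P)) (trans (cong ι (sym (ℕ.+-suc k r))) (ι-+ k (suc r))) ⟩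
  - ((ι k + ι (suc r)) * ι ((k ℕ.+ r) C k) * P)
    ≡⟨ expand (ι ((k ℕ.+ r) C k)) P (ι k) (ι (suc r)) (ι j) ⟩
  ι ((k ℕ.+ r) C k) * (P * (- (ι k + ι (suc r) + ι j) + ι j))
    ≡⟨ cong (λ ν → ι ((k ℕ.+ r) C k) * (P * (- ν + ι j))) ν≡k+[1+r]+j ⟨
  ι ((k ℕ.+ r) C k) * (P * (- ι n + ι j)) ∎
  where
  P = poch (- ι n) j
  k+j+[1+r]≡n : k ℕ.+ j ℕ.+ suc r ≡ n
  k+j+[1+r]≡n = trans (shuffle k j r) k+[1+j]+r≡n
    where
    shuffle : ∀ k j r → k ℕ.+ j ℕ.+ suc r ≡ k ℕ.+ suc j ℕ.+ r
    shuffle = ℕ-Solver.solve-∀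
  ν≡k+[1+r]+j : ι n ≡ ι k + ι (suc r) + ι j
  ν≡k+[1+r]+j = begin
    ι n                          ≡⟨ cong ι (trans (sym k+[1+j]+r≡n) (shuffle k j r)) ⟩
    ι (k ℕ.+ suc r ℕ.+ j)        ≡⟨ ι-+ (k ℕ.+ suc r) j ⟩
    ι (k ℕ.+ suc r) + ι j        ≡⟨ cong (_+ ι j) (ι-+ k (suc r)) ⟩
    ι k + ι (suc r) + ι j        ∎
    where
    shuffle : ∀ k j r → k ℕ.+ suc j ℕ.+ r ≡ k ℕ.+ suc r ℕ.+ j
    shuffle = ℕ-Solver.solve-∀
  collapse : ∀ c p k r j → c * p * (k - (k + r + j) + j) ≡ - (r * c * p)
  collapse = solve-∀ ℚ-ring
  expand : ∀ c p k r j → - ((k + r) * c * p) ≡ c * (p * (- (k + r + j) + j))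
  expand = solve-∀ ℚ-ring

1^j≡1 : ∀ j → 1ℚ ^ j ≡ 1ℚ
1^j≡1 zero    = refl
1^j≡1 (suc j) = cong (1ℚ *_) (1^j≡1 j)

[-1]^[k+d]*[-x]^k≡[-1]^d*x^k : ∀ k d x → (- 1ℚ) ^ (k ℕ.+ d) * (- x) ^ k ≡ (- 1ℚ) ^ d * x ^ k
[-1]^[k+d]*[-x]^k≡[-1]^d*x^k zero    d x = refl
[-1]^[k+d]*[-x]^k≡[-1]^d*x^k (suc k) d x = begin
  (- 1ℚ * s) * (- x * p)   ≡⟨ signs s p x ⟩
  (s * p) * x              ≡⟨ cong (_* x) ([-1]^[k+d]*[-x]^k≡[-1]^d*x^k k d x) ⟩
  ((- 1ℚ) ^ d * x ^ k) * x ≡⟨ signs′ ((- 1ℚ) ^ d) (x ^ k) x ⟩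
  (- 1ℚ) ^ d * (x * x ^ k) ∎
  where
  s = (- 1ℚ) ^ (k ℕ.+ d)
  p = (- x) ^ k
  signs : ∀ s p x → (- 1ℚ * s) * (- x * p) ≡ (s * p) * x
  signs = solve-∀ ℚ-ring
  signs′ : ∀ s p x → (s * p) * x ≡ s * (x * p)
  signs′ = solve-∀ ℚ-ring

[-1]^n*[-x]^k≡[-1]^[n∸k]*x^k : ∀ {n k} x → k ≤ n → (- 1ℚ) ^ n * (- x) ^ k ≡ (- 1ℚ) ^ (n ∸ k) * x ^ k
[-1]^n*[-x]^k≡[-1]^[n∸k]*x^k {n} {k} x k≤n =
  subst (λ m → (- 1ℚ) ^ m * (- x) ^ k ≡ (- 1ℚ) ^ (n ∸ k) * x ^ k) (ℕ.m+[n∸m]≡n k≤n)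
        ([-1]^[k+d]*[-x]^k≡[-1]^d*x^k k (n ∸ k) x)

Σ0to-cong : ∀ N {f g : ℕ → ℚ} → (∀ j → j ≤ N → f j ≡ g j) → Σ0to N f ≡ Σ0to N g
Σ0to-cong zero    f≗g = f≗g 0 z≤n
Σ0to-cong (suc N) f≗g = cong₂ _+_ (Σ0to-cong N (λ j j≤N → f≗g j (ℕ.m≤n⇒m≤1+n j≤N))) (f≗g (suc N) ℕ.≤-refl)

Σ0to-*ˡ : ∀ N c (f : ℕ → ℚ) → Σ0to N (λ j → c * f j) ≡ c * Σ0to N f
Σ0to-*ˡ zero    c f = refl
Σ0to-*ˡ (suc N) c f = trans (cong (_+ c * f (suc N)) (Σ0to-*ˡ N c f)) (sym (*-distribˡ-+ c (Σ0to N f) (f (suc N))))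

Σ0to-+ : ∀ N (f g : ℕ → ℚ) → Σ0to N (λ j → f j + g j) ≡ Σ0to N f + Σ0to N g
Σ0to-+ zero    f g = refl
Σ0to-+ (suc N) f g =
  trans (cong (_+ (f (suc N) + g (suc N))) (Σ0to-+ N f g)) (swap (Σ0to N f) (Σ0to N g) (f (suc N)) (g (suc N)))
  where
  swap : ∀ a b c d → a + b + (c + d) ≡ a + c + (b + d)
  swap = solve-∀ ℚ-ring

Σ0to-linear : ∀ N b c (f g h : ℕ → ℚ) →
  Σ0to N (λ j → f j + b * g j - c * h j) ≡ Σ0to N f + b * Σ0to N g - c * Σ0to N h
Σ0to-linear zero    b c f g h = refl
Σ0to-linear (suc N) b c f g h =
  trans (cong (_+ (f (suc N) + b * g (suc N) - c * h (suc N))) (Σ0to-linear N b c f g h))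
        (collect b c (Σ0to N f) (Σ0to N g) (Σ0to N h) (f (suc N)) (g (suc N)) (h (suc N)))
  where
  collect : ∀ b c F G H f g h → F + b * G - c * H + (f + b * g - c * h) ≡ (F + f) + b * (G + g) - c * (H + h)
  collect = solve-∀ ℚ-ring

Σ0to-telescope : ∀ N (d : ℕ → ℚ) → Σ0to N (λ j → d j - d (suc j)) ≡ d 0 - d (suc N)
Σ0to-telescope zero    d = refl
Σ0to-telescope (suc N) d =
  trans (cong (_+ (d (suc N) - d (suc (suc N)))) (Σ0to-telescope N d)) (cancel (d 0) (d (suc N)) (d (suc (suc N))))
  where
  cancel : ∀ a b c → a - b + (b - c) ≡ a - c
  cancel = solve-∀ ℚ-ring

Σ0to-suc : ∀ N (f : ℕ → ℚ) → Σ0to (suc N) f ≡ f 0 + Σ0to N (λ j → f (suc j))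
Σ0to-suc zero    f = refl
Σ0to-suc (suc N) f = trans (cong (_+ f (suc (suc N))) (Σ0to-suc N f)) (+-assoc (f 0) _ _)

Σ0to-extend : ∀ {N M} f → N ≤ M → (∀ j → N < j → f j ≡ 0ℚ) → Σ0to M f ≡ Σ0to N f
Σ0to-extend {N} f N≤M vanish = go (ℕ.≤⇒≤′ N≤M)
  where
  go : ∀ {M} → N ℕ.≤′ M → Σ0to M f ≡ Σ0to N f
  go (ℕ.≤′-reflexive refl) = refl
  go (ℕ.≤′-step {M} N≤′M)  = begin
    Σ0to M f + f (suc M) ≡⟨ cong₂ _+_ (go N≤′M) (vanish (suc M) (s≤s (ℕ.≤′⇒≤ N≤′M))) ⟩
    Σ0to N f + 0ℚ        ≡⟨ +-identityʳ _ ⟩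
    Σ0to N f             ∎

Σ0to-vanish : ∀ N (f : ℕ → ℚ) → (∀ j → f j ≡ 0ℚ) → Σ0to N f ≡ 0ℚ
Σ0to-vanish zero    f f≗0 = f≗0 0
Σ0to-vanish (suc N) f f≗0 = trans (cong₂ _+_ (Σ0to-vanish N f f≗0) (f≗0 (suc N))) (+-identityʳ 0ℚ)

poly : ℕ → (ℕ → ℚ) → ℚ → ℚ
poly N c t = Σ0to N (λ k → c k * t ^ k)

shift : (ℕ → ℚ) → ℕ → ℚ
shift c zero    = 0ℚ
shift c (suc k) = c k

poly-extend : ∀ {N M} c t → N ≤ M → (∀ k → N < k → c k ≡ 0ℚ) → poly M c t ≡ poly N c t
poly-extend c t N≤M vanish =
  Σ0to-extend (λ k → c k * t ^ k) N≤M (λ k N<k → trans (cong (_* t ^ k) (vanish k N<k)) (*-zeroˡ (t ^ k)))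

poly-shift : ∀ N c t → poly (suc N) (shift c) t ≡ t * poly N c t
poly-shift N c t = begin
  poly (suc N) (shift c) t                 ≡⟨ Σ0to-suc N (λ k → shift c k * t ^ k) ⟩
  0ℚ * 1ℚ + Σ0to N (λ k → c k * (t * t ^ k)) ≡⟨ cong (0ℚ * 1ℚ +_) (Σ0to-cong N (λ k _ → rearrange (c k) t (t ^ k))) ⟩
  0ℚ * 1ℚ + Σ0to N (λ k → t * (c k * t ^ k)) ≡⟨ cong (0ℚ * 1ℚ +_) (Σ0to-*ˡ N t (λ k → c k * t ^ k)) ⟩
  0ℚ * 1ℚ + t * poly N c t                  ≡⟨ +-identityˡ (t * poly N c t) ⟩
  t * poly N c t                            ∎
  where
  rearrange : ∀ c t p → c * (t * p) ≡ t * (c * p)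
  rearrange = solve-∀ ℚ-ring

poly-three-term : ∀ n b l {c₀ c₁ c₂ : ℕ → ℚ} t →
  (∀ k → n < k → c₀ k ≡ 0ℚ) → (∀ k → suc n < k → c₁ k ≡ 0ℚ) →
  (∀ k → c₂ k ≡ shift c₁ k + b * c₁ k - l * c₀ k) →
  poly (suc (suc n)) c₂ t ≡ (t + b) * poly (suc n) c₁ t - l * poly n c₀ t
poly-three-term n b l {c₀} {c₁} {c₂} t deg-c₀ deg-c₁ rec = begin
  poly (suc (suc n)) c₂ t
    ≡⟨ Σ0to-cong (suc (suc n)) (λ k _ → trans (cong (_* t ^ k) (rec k)) (distrib (shift c₁ k) (c₁ k) (c₀ k) b l (t ^ k))) ⟩
  Σ0to (suc (suc n)) (λ k → shift c₁ k * t ^ k + b * (c₁ k * t ^ k) - l * (c₀ k * t ^ k))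
    ≡⟨ Σ0to-linear (suc (suc n)) b l _ _ _ ⟩
  poly (suc (suc n)) (shift c₁) t + b * poly (suc (suc n)) c₁ t - l * poly (suc (suc n)) c₀ t
    ≡⟨ cong₂ (λ p q → poly (suc (suc n)) (shift c₁) t + b * p - l * q)
             (poly-extend c₁ t (ℕ.n≤1+n (suc n)) deg-c₁)
             (poly-extend c₀ t (ℕ.m≤n+m n 2) deg-c₀) ⟩
  poly (suc (suc n)) (shift c₁) t + b * poly (suc n) c₁ t - l * poly n c₀ t
    ≡⟨ cong (λ p → p + b * poly (suc n) c₁ t - l * poly n c₀ t) (poly-shift (suc n) c₁ t) ⟩
  t * poly (suc n) c₁ t + b * poly (suc n) c₁ t - l * poly n c₀ t
    ≡⟨ factor t b l (poly (suc n) c₁ t) (poly n c₀ t) ⟩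
  (t + b) * poly (suc n) c₁ t - l * poly n c₀ t ∎
  where
  distrib : ∀ s c₁ c₀ b l p → (s + b * c₁ - l * c₀) * p ≡ s * p + b * (c₁ * p) - l * (c₀ * p)
  distrib = solve-∀ ℚ-ring
  factor : ∀ t b l P₁ P₀ → t * P₁ + b * P₁ - l * P₀ ≡ (t + b) * P₁ - l * P₀
  factor = solve-∀ ℚ-ring

-- Laguerre coefficients

lag : ℕ → ℕ → ℚ → ℚ
lag m k a = ι (m C k) * poch (a + ι k) (m ∸ k)

lag-vanish : ∀ {m k} a → m < k → lag m k a ≡ 0ℚ
lag-vanish {m} {k} a m<k =
  trans (cong (λ c → ι c * poch (a + ι k) (m ∸ k)) (k>n⇒nCk≡0 m<k)) (*-zeroˡ (poch (a + ι k) (m ∸ k)))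

lag-diag : ∀ k a → lag k k a ≡ 1ℚ
lag-diag k a = cong₂ (λ c d → ι c * poch (a + ι k) d) (nCn≡1 k) (ℕ.n∸n≡0 k)

lag-+ : ∀ {m} k r a → k ℕ.+ r ≡ m → lag m k a ≡ ι (m C k) * poch (a + ι k) r
lag-+ k r a refl = cong (λ d → ι ((k ℕ.+ r) C k) * poch (a + ι k) d) (ℕ.m+n∸m≡n k r)

lag-pascal-k<m : ∀ k r a → let m = suc (k ℕ.+ r) in
  lag (suc m) (suc k) a ≡ lag m k (a + 1ℚ) + (ι m + a) * lag m (suc k) a
lag-pascal-k<m k r a = begin
  lag (suc m) (suc k) a                       ≡⟨ lag-+ (suc k) (suc r) a (cong suc (ℕ.+-suc k r)) ⟩
  ι (suc m C suc k) * (P * (b + ι r))         ≡⟨ cong (λ c → ι c * (P * (b + ι r))) (nCk+nC[k+1]≡[n+1]C[k+1] m k) ⟨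
  ι (m C k ℕ.+ m C suc k) * (P * (b + ι r))   ≡⟨ cong₂ (λ c s → c * (P * s)) (ι-+ (m C k) (m C suc k)) b+r≡m+a ⟩
  (ι (m C k) + ι (m C suc k)) * (P * (ι m + a))  ≡⟨ distrib (ι (m C k)) (ι (m C suc k)) P (ι m + a) ⟩
  ι (m C k) * (P * (ι m + a)) + (ι m + a) * (ι (m C suc k) * P)
    ≡⟨ cong₂ (λ p q → p + (ι m + a) * q) lowered (sym (lag-+ (suc k) r a refl)) ⟩
  lag m k (a + 1ℚ) + (ι m + a) * lag m (suc k) a ∎
  where
  m = suc (k ℕ.+ r)
  b = a + ι (suc k)
  P = poch b r
  b+r≡m+a : b + ι r ≡ ι m + a
  b+r≡m+a = begin
    a + ι (suc k) + ι r        ≡⟨ cong (λ i → a + i + ι r) (ι-suc k) ⟩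
    a + (1ℚ + ι k) + ι r       ≡⟨ regroup a (ι k) (ι r) ⟩
    1ℚ + (ι k + ι r) + a       ≡⟨ cong (λ i → 1ℚ + i + a) (ι-+ k r) ⟨
    1ℚ + ι (k ℕ.+ r) + a       ≡⟨ cong (_+ a) (ι-suc (k ℕ.+ r)) ⟨
    ι m + a                    ∎
    where
    regroup : ∀ a i j → a + (1ℚ + i) + j ≡ 1ℚ + (i + j) + a
    regroup = solve-∀ ℚ-ring
  lowered : ι (m C k) * (P * (ι m + a)) ≡ lag m k (a + 1ℚ)
  lowered = sym (begin
    lag m k (a + 1ℚ)                          ≡⟨ lag-+ k (suc r) (a + 1ℚ) (ℕ.+-suc k r) ⟩
    ι (m C k) * poch (a + 1ℚ + ι k) (suc r)
      ≡⟨ cong (λ c → ι (m C k) * poch c (suc r)) (trans (regroup a (ι k)) (cong (a +_) (sym (ι-suc k)))) ⟩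
    ι (m C k) * (P * (b + ι r))               ≡⟨ cong (λ s → ι (m C k) * (P * s)) b+r≡m+a ⟩
    ι (m C k) * (P * (ι m + a))               ∎)
    where
    regroup : ∀ a i → a + 1ℚ + i ≡ a + (1ℚ + i)
    regroup = solve-∀ ℚ-ring
  distrib : ∀ c d p s → (c + d) * (p * s) ≡ c * (p * s) + s * (d * p)
  distrib = solve-∀ ℚ-ring

lag-pascal : ∀ m k a → lag (suc m) (suc k) a ≡ lag m k (a + 1ℚ) + (ι m + a) * lag m (suc k) a
lag-pascal m k a = by-ordering a (ℕ.compare m k)
  where
  by-ordering : ∀ {m k} a → ℕ.Ordering m k → lag (suc m) (suc k) a ≡ lag m k (a + 1ℚ) + (ι m + a) * lag m (suc k) a
  by-ordering a (ℕ.less m r) = begin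
    lag (suc m) (suc (suc (m ℕ.+ r))) a         ≡⟨ lag-vanish a (s≤s m<k) ⟩
    0ℚ                                          ≡⟨ x+c*0≡x 0ℚ (ι m + a) ⟨
    0ℚ + (ι m + a) * 0ℚ
      ≡⟨ cong₂ (λ p q → p + (ι m + a) * q) (lag-vanish (a + 1ℚ) m<k) (lag-vanish a (ℕ.m<n⇒m<1+n m<k)) ⟨
    lag m (suc (m ℕ.+ r)) (a + 1ℚ) + (ι m + a) * lag m (suc (suc (m ℕ.+ r))) a ∎
    where
    m<k : m < suc (m ℕ.+ r)
    m<k = s≤s (ℕ.m≤m+n m r)
  by-ordering a (ℕ.equal m) = begin
    lag (suc m) (suc m) a                       ≡⟨ lag-diag (suc m) a ⟩
    1ℚ                                          ≡⟨ x+c*0≡x 1ℚ (ι m + a) ⟨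
    1ℚ + (ι m + a) * 0ℚ
      ≡⟨ cong₂ (λ p q → p + (ι m + a) * q) (lag-diag m (a + 1ℚ)) (lag-vanish a (ℕ.n<1+n m)) ⟨
    lag m m (a + 1ℚ) + (ι m + a) * lag m (suc m) a ∎
  by-ordering a (ℕ.greater k r) = lag-pascal-k<m k r a

lag-param-suc-k≤m : ∀ k r a → let m = k ℕ.+ r in
  lag (suc m) k a ≡ lag (suc m) k (a + 1ℚ) - ι (suc m) * lag m k (a + 1ℚ)
lag-param-suc-k≤m k r a = begin
  lag (suc m) k a                                  ≡⟨ lag-+ k (suc r) a (ℕ.+-suc k r) ⟩
  ι (suc m C k) * poch b (suc r)                   ≡⟨ cong (ι (suc m C k) *_) (poch-suc b r) ⟩
  ι (suc m C k) * (b * P)                          ≡⟨ split (ι (suc m C k)) b P (ι r) ⟩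
  ι (suc m C k) * (P * (b + 1ℚ + ι r)) - (1ℚ + ι r) * ι (suc m C k) * P
    ≡⟨ cong (λ c → ι (suc m C k) * (P * (b + 1ℚ + ι r)) - c * ι (suc m C k) * P) (ι-suc r) ⟨
  ι (suc m C k) * (P * (b + 1ℚ + ι r)) - ι (suc r) * ι (suc m C k) * P
    ≡⟨ cong (λ c → ι (suc m C k) * (P * (b + 1ℚ + ι r)) - c * P) (ι-C-absorption-complement k r) ⟩
  ι (suc m C k) * (P * (b + 1ℚ + ι r)) - ι (suc m) * ι (m C k) * P
    ≡⟨ cong₂ _-_ raised (*-assoc (ι (suc m)) (ι (m C k)) P) ⟩
  lag (suc m) k (a + 1ℚ) - ι (suc m) * (ι (m C k) * P)
    ≡⟨ cong (λ q → lag (suc m) k (a + 1ℚ) - ι (suc m) * q) lowered ⟩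
  lag (suc m) k (a + 1ℚ) - ι (suc m) * lag m k (a + 1ℚ) ∎
  where
  m = k ℕ.+ r
  b = a + ι k
  P = poch (b + 1ℚ) r
  a+1+k≡b+1 : a + 1ℚ + ι k ≡ b + 1ℚ
  a+1+k≡b+1 = regroup a (ι k)
    where
    regroup : ∀ a i → a + 1ℚ + i ≡ a + i + 1ℚ
    regroup = solve-∀ ℚ-ring
  raised : ι (suc m C k) * (P * (b + 1ℚ + ι r)) ≡ lag (suc m) k (a + 1ℚ)
  raised = sym (trans (lag-+ k (suc r) (a + 1ℚ) (ℕ.+-suc k r)) (cong (λ c → ι (suc m C k) * poch c (suc r)) a+1+k≡b+1))
  lowered : ι (m C k) * P ≡ lag m k (a + 1ℚ)
  lowered = sym (trans (lag-+ k r (a + 1ℚ) refl) (cong (λ c → ι (m C k) * poch c r) a+1+k≡b+1))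
  split : ∀ c b p i → c * (b * p) ≡ c * (p * (b + 1ℚ + i)) - (1ℚ + i) * c * p
  split = solve-∀ ℚ-ring

lag-param-suc : ∀ m k a → lag (suc m) k a ≡ lag (suc m) k (a + 1ℚ) - ι (suc m) * lag m k (a + 1ℚ)
lag-param-suc m k a = by-ordering a (ℕ.compare (suc m) k)
  where
  by-ordering : ∀ {m k} a → ℕ.Ordering (suc m) k → lag (suc m) k a ≡ lag (suc m) k (a + 1ℚ) - ι (suc m) * lag m k (a + 1ℚ)
  by-ordering {m} a (ℕ.less _ r) = begin
    lag (suc m) (suc (suc m ℕ.+ r)) a                ≡⟨ lag-vanish a 1+m<k ⟩
    0ℚ                                               ≡⟨ x-c*0≡x 0ℚ (ι (suc m)) ⟨
    0ℚ - ι (suc m) * 0ℚ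
      ≡⟨ cong₂ (λ p q → p - ι (suc m) * q) (lag-vanish (a + 1ℚ) 1+m<k) (lag-vanish (a + 1ℚ) (ℕ.<-trans (ℕ.n<1+n m) 1+m<k)) ⟨
    lag (suc m) (suc (suc m ℕ.+ r)) (a + 1ℚ) - ι (suc m) * lag m (suc (suc m ℕ.+ r)) (a + 1ℚ) ∎
    where
    1+m<k : suc m < suc (suc m ℕ.+ r)
    1+m<k = s≤s (ℕ.m≤m+n (suc m) r)
  by-ordering {m} a (ℕ.equal _) = begin
    lag (suc m) (suc m) a                            ≡⟨ lag-diag (suc m) a ⟩
    1ℚ                                               ≡⟨ x-c*0≡x 1ℚ (ι (suc m)) ⟨
    1ℚ - ι (suc m) * 0ℚ
      ≡⟨ cong₂ (λ p q → p - ι (suc m) * q) (lag-diag (suc m) (a + 1ℚ)) (lag-vanish (a + 1ℚ) (ℕ.n<1+n m)) ⟨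
    lag (suc m) (suc m) (a + 1ℚ) - ι (suc m) * lag m (suc m) (a + 1ℚ) ∎
  by-ordering a (ℕ.greater k r) = lag-param-suc-k≤m k r a

-- lag (m - j) k a, except that it is 0 (rather than lag 0 k a) when j > m.
lagShift : ℕ → ℕ → ℕ → ℚ → ℚ
lagShift m       zero    k a = lag m k a
lagShift zero    (suc j) k a = 0ℚ
lagShift (suc m) (suc j) k a = lagShift m j k a

lagShift-vanish : ∀ m j k a → m < j ℕ.+ k → lagShift m j k a ≡ 0ℚ
lagShift-vanish m       zero    k a m<k = lag-vanish a m<k
lagShift-vanish zero    (suc j) k a _   = refl
lagShift-vanish (suc m) (suc j) k a m<j+k = lagShift-vanish m j k a (ℕ.s≤s⁻¹ m<j+k)

lagShift-lag : ∀ m j k a → j ≤ m → lagShift m j k a ≡ lag (m ∸ j) k a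
lagShift-lag m       zero    k a _   = refl
lagShift-lag (suc m) (suc j) k a j≤m = lagShift-lag m j k a (ℕ.s≤s⁻¹ j≤m)

lagShift-+ : ∀ k j r a → lagShift (k ℕ.+ j ℕ.+ r) j k a ≡ ι ((k ℕ.+ r) C k) * poch (a + ι k) r
lagShift-+ k j r a = begin
  lagShift (k ℕ.+ j ℕ.+ r) j k a
    ≡⟨ lagShift-lag (k ℕ.+ j ℕ.+ r) j k a (ℕ.≤-trans (ℕ.m≤n+m j k) (ℕ.m≤m+n (k ℕ.+ j) r)) ⟩
  lag (k ℕ.+ j ℕ.+ r ∸ j) k a        ≡⟨ lag-+ k r a k+r≡n∸j ⟩
  ι ((k ℕ.+ j ℕ.+ r ∸ j) C k) * poch (a + ι k) r ≡⟨ cong (λ m → ι (m C k) * poch (a + ι k) r) k+r≡n∸j ⟨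
  ι ((k ℕ.+ r) C k) * poch (a + ι k) r ∎
  where
  shuffle : ∀ k j r → k ℕ.+ j ℕ.+ r ≡ j ℕ.+ (k ℕ.+ r)
  shuffle = ℕ-Solver.solve-∀
  k+r≡n∸j : k ℕ.+ r ≡ k ℕ.+ j ℕ.+ r ∸ j
  k+r≡n∸j = sym (trans (cong (_∸ j) (shuffle k j r)) (ℕ.m+n∸m≡n j (k ℕ.+ r)))

lagShift-constant : ∀ j k a b → lagShift 0 j k a ≡ lagShift 0 j k b
lagShift-constant zero    zero    a b = refl
lagShift-constant zero    (suc k) a b = refl
lagShift-constant (suc j) k a b = refl

lagShift-pascal : ∀ m j k a →
  lagShift (suc m) j (suc k) a ≡ lagShift m j k (a + 1ℚ) + (ι m - ι j + a) * lagShift m j (suc k) a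
lagShift-pascal m zero k a =
  trans (lag-pascal m k a) (cong (λ c → lag m k (a + 1ℚ) + c * lag m (suc k) a) (minus-zero (ι m) a))
  where
  minus-zero : ∀ m a → m + a ≡ m - 0ℚ + a
  minus-zero = solve-∀ ℚ-ring
lagShift-pascal zero (suc j) k a = begin
  lagShift 0 j (suc k) a                ≡⟨ lagShift-vanish 0 j (suc k) a (ℕ.≤-trans (s≤s z≤n) (ℕ.m≤n+m (suc k) j)) ⟩
  0ℚ                                    ≡⟨ x+c*0≡x 0ℚ (ι 0 - ι (suc j) + a) ⟨
  0ℚ + (ι 0 - ι (suc j) + a) * 0ℚ       ∎
lagShift-pascal (suc m) (suc j) k a =
  trans (lagShift-pascal m j k a)
        (cong (λ c → lagShift m j k (a + 1ℚ) + (c + a) * lagShift m j (suc k) a) (sym (ι[1+m]-ι[1+j]≡ι[m]-ι[j] m j)))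

lagShift-param-suc : ∀ m j k a →
  lagShift (suc m) j k a ≡ lagShift (suc m) j k (a + 1ℚ) - (ι (suc m) - ι j) * lagShift m j k (a + 1ℚ)
lagShift-param-suc m zero k a =
  trans (lag-param-suc m k a) (cong (λ c → lag (suc m) k (a + 1ℚ) - c * lag m k (a + 1ℚ)) (minus-zero (ι (suc m))))
  where
  minus-zero : ∀ m → m ≡ m - 0ℚ
  minus-zero = solve-∀ ℚ-ring
lagShift-param-suc zero (suc j) k a =
  trans (lagShift-constant j k a (a + 1ℚ)) (sym (x-c*0≡x (lagShift 0 j k (a + 1ℚ)) (ι 1 - ι (suc j))))
lagShift-param-suc (suc m) (suc j) k a =
  trans (lagShift-param-suc m j k a)
        (cong (λ c → lagShift (suc m) j k (a + 1ℚ) - c * lagShift m j k (a + 1ℚ)) (sym (ι[1+m]-ι[1+j]≡ι[m]-ι[j] (suc m) j)))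

-- The coefficients of (-1)ⁿ L⁽²⁾ₙ(-t)

module _ (X Y : ℚ) where

  weight : ℕ → ℕ → ℚ
  weight j k = ι (multichoose k j) * poch (Y - 1ℚ) j

  weight-vanish : ∀ j → weight (suc j) 0 ≡ 0ℚ
  weight-vanish j =
    trans (cong (λ c → ι c * poch (Y - 1ℚ) (suc j)) (multichoose-zeroˡ j)) (*-zeroˡ (poch (Y - 1ℚ) (suc j)))

  weight-pascal : ∀ j k → weight (suc j) (suc k) ≡ weight (suc j) k + (Y - 1ℚ + ι j) * weight j (suc k)
  weight-pascal j k = begin
    ι (multichoose (suc k) (suc j)) * (p * s)
      ≡⟨ cong (λ c → ι c * (p * s)) (multichoose-pascal k j) ⟩
    ι (multichoose k (suc j) ℕ.+ multichoose (suc k) j) * (p * s) ≡⟨ cong (_* (p * s)) (ι-+ (multichoose k (suc j)) _) ⟩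
    (ι (multichoose k (suc j)) + ι (multichoose (suc k) j)) * (p * s)
      ≡⟨ distrib (ι (multichoose k (suc j))) (ι (multichoose (suc k) j)) p s ⟩
    ι (multichoose k (suc j)) * (p * s) + s * (ι (multichoose (suc k) j) * p) ∎
    where
    p = poch (Y - 1ℚ) j
    s = Y - 1ℚ + ι j
    distrib : ∀ c d p s → (c + d) * (p * s) ≡ c * (p * s) + s * (d * p)
    distrib = solve-∀ ℚ-ring

  term : ℕ → ℕ → ℕ → ℚ
  term m k j = weight j k * lagShift m j k (X + ι j)

  coeff : ℕ → ℕ → ℚ
  coeff m k = Σ0to m (term m k)

  term-vanish : ∀ m k j → m < j ℕ.+ k → term m k j ≡ 0ℚ
  term-vanish m k j m<j+k = trans (cong (weight j k *_) (lagShift-vanish m j k (X + ι j) m<j+k)) (*-zeroʳ (weight j k))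

  coeff-vanish : ∀ m k → m < k → coeff m k ≡ 0ℚ
  coeff-vanish m k m<k = Σ0to-vanish m (term m k) (λ j → term-vanish m k j (ℕ.<-≤-trans m<k (ℕ.m≤n+m k j)))

  coeff-extend : ∀ {m M} k → m ≤ M → Σ0to M (term m k) ≡ coeff m k
  coeff-extend {m} k m≤M = Σ0to-extend (term m k) m≤M (λ j m<j → term-vanish m k j (ℕ.<-≤-trans m<j (ℕ.m≤m+n j k)))

  coeff-zero : ∀ m → coeff m 0 ≡ poch X m
  coeff-zero m = begin
    Σ0to m (term m 0)                           ≡⟨ Σ0to-extend (term m 0) (z≤n {m}) (λ { (suc j) _ → only-j≡0 j }) ⟩
    1ℚ * (1ℚ * poch (X + 0ℚ + 0ℚ) m)            ≡⟨ cong (λ a → 1ℚ * (1ℚ * poch a m)) (X+0+0≡X X) ⟩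
    1ℚ * (1ℚ * poch X m)                        ≡⟨ trans (*-identityˡ _) (*-identityˡ _) ⟩
    poch X m                                    ∎
    where
    only-j≡0 : ∀ j → term m 0 (suc j) ≡ 0ℚ
    only-j≡0 j = trans (cong (_* w) (weight-vanish j)) (*-zeroˡ w)
      where w = lagShift m (suc j) 0 (X + ι (suc j))
    X+0+0≡X : ∀ X → X + 0ℚ + 0ℚ ≡ X
    X+0+0≡X = solve-∀ ℚ-ring

  coeff-diag : ∀ m → coeff m m ≡ 1ℚ
  coeff-diag m = begin
    Σ0to m (term m m)           ≡⟨ Σ0to-extend (term m m) (z≤n {m}) (λ j 0<j → term-vanish m m j (ℕ.m<n+m m 0<j)) ⟩
    weight 0 m * lag m m (X + ι 0) ≡⟨ cong (weight 0 m *_) (lag-diag m (X + ι 0)) ⟩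
    1ℚ * 1ℚ                     ≡⟨ *-identityˡ 1ℚ ⟩
    1ℚ ∎

  bcoef-suc : ∀ n → bcoef X Y (suc n) ≡ X + ι n + (Y + ι n) + 1ℚ
  bcoef-suc n = begin
    ι (2 ℕ.* suc n) + X + Y - 1ℚ           ≡⟨ cong (λ c → c + X + Y - 1ℚ) (ι-* 2 (suc n)) ⟩
    ι 2 * ι (suc n) + X + Y - 1ℚ           ≡⟨ cong₂ (λ c d → c * d + X + Y - 1ℚ) (ι-suc 1) (ι-suc n) ⟩
    (1ℚ + 1ℚ) * (1ℚ + ι n) + X + Y - 1ℚ    ≡⟨ regroup X Y (ι n) ⟩
    X + ι n + (Y + ι n) + 1ℚ               ∎
    where
    regroup : ∀ X Y n → (1ℚ + 1ℚ) * (1ℚ + n) + X + Y - 1ℚ ≡ X + n + (Y + n) + 1ℚ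
    regroup = solve-∀ ℚ-ring

  λcoef-suc : ∀ n → λcoef X Y (suc n) ≡ (X + ι n) * (Y + ι n)
  λcoef-suc n = trans (cong (λ c → (c - 1ℚ + X) * (c - 1ℚ + Y)) (ι-suc n)) (regroup X Y (ι n))
    where
    regroup : ∀ X Y n → (1ℚ + n - 1ℚ + X) * (1ℚ + n - 1ℚ + Y) ≡ (X + n) * (Y + n)
    regroup = solve-∀ ℚ-ring

  lagShift-recurrence : ∀ n j k →
    lagShift (suc (suc n)) j (suc k) (X + ι j)
      ≡ lagShift (suc n) j k (X + ι j) + bcoef X Y (suc n) * lagShift (suc n) j (suc k) (X + ι j)
        - λcoef X Y (suc n) * lagShift n j (suc k) (X + ι j) - (Y - 1ℚ + ι j) * lagShift n j k (X + ι j + 1ℚ)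
  lagShift-recurrence n j k = begin
    lagShift (suc (suc n)) j (suc k) a
      ≡⟨ lagShift-pascal (suc n) j k a ⟩
    A₂ + (ι (suc n) - ι j + a) * lagShift (suc n) j (suc k) a
      ≡⟨ cong₂ (λ i w → A₂ + (i - ι j + a) * w) (ι-suc n) (lagShift-pascal n j k a) ⟩
    A₂ + (1ℚ + ι n - ι j + a) * (A₄ + c * A₅)
      ≡⟨ identity (ι n) (ι j) X Y A₂ A₄ A₅ ⟩
    A₂ - (1ℚ + ι n - ι j) * A₄ + (X + ι n + (Y + ι n) + 1ℚ) * (A₄ + c * A₅) - (X + ι n) * (Y + ι n) * A₅ - s * A₄
      ≡⟨ cong₂ (λ i b → A₂ - (i - ι j) * A₄ + b * (A₄ + c * A₅) - (X + ι n) * (Y + ι n) * A₅ - s * A₄)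
               (sym (ι-suc n)) (sym (bcoef-suc n)) ⟩
    A₂ - (ι (suc n) - ι j) * A₄ + bcoef X Y (suc n) * (A₄ + c * A₅) - (X + ι n) * (Y + ι n) * A₅ - s * A₄
      ≡⟨ cong₂ (λ w l → w + bcoef X Y (suc n) * (A₄ + c * A₅) - l * A₅ - s * A₄)
               (sym (lagShift-param-suc n j k a)) (sym (λcoef-suc n)) ⟩
    lagShift (suc n) j k a + bcoef X Y (suc n) * (A₄ + c * A₅) - λcoef X Y (suc n) * A₅ - s * A₄
      ≡⟨ cong (λ w → lagShift (suc n) j k a + bcoef X Y (suc n) * w - λcoef X Y (suc n) * A₅ - s * A₄)
              (sym (lagShift-pascal n j k a)) ⟩
    lagShift (suc n) j k a + bcoef X Y (suc n) * lagShift (suc n) j (suc k) a - λcoef X Y (suc n) * A₅ - s * A₄ ∎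
    where
    a  = X + ι j
    s  = Y - 1ℚ + ι j
    c  = ι n - ι j + a
    A₂ = lagShift (suc n) j k (a + 1ℚ)
    A₄ = lagShift n j k (a + 1ℚ)
    A₅ = lagShift n j (suc k) a
    identity : ∀ n j X Y A₂ A₄ A₅ →
      A₂ + (1ℚ + n - j + (X + j)) * (A₄ + (n - j + (X + j)) * A₅)
        ≡ A₂ - (1ℚ + n - j) * A₄ + (X + n + (Y + n) + 1ℚ) * (A₄ + (n - j + (X + j)) * A₅)
          - (X + n) * (Y + n) * A₅ - (Y - 1ℚ + j) * A₄
    identity = solve-∀ ℚ-ring

  defect : ℕ → ℕ → ℕ → ℚ
  defect n k j = (weight j (suc k) - weight j k) * lagShift (suc n) j k (X + ι j)

  defect-zero : ∀ n k → defect n k 0 ≡ 0ℚ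
  defect-zero n k = cancel (lagShift (suc n) 0 k (X + ι 0))
    where
    cancel : ∀ w → (1ℚ - 1ℚ) * w ≡ 0ℚ
    cancel = solve-∀ ℚ-ring

  defect-suc : ∀ n k j → defect n k (suc j) ≡ (Y - 1ℚ + ι j) * weight j (suc k) * lagShift n j k (X + ι j + 1ℚ)
  defect-suc n k j = begin
    (weight (suc j) (suc k) - weight (suc j) k) * lagShift n j k (X + ι (suc j))
      ≡⟨ cong₂ (λ g a → (g - weight (suc j) k) * lagShift n j k a) (weight-pascal j k) X+ι[1+j]≡X+ι[j]+1 ⟩
    (weight (suc j) k + s * weight j (suc k) - weight (suc j) k) * lagShift n j k (X + ι j + 1ℚ)
      ≡⟨ cancel (weight (suc j) k) s (weight j (suc k)) (lagShift n j k (X + ι j + 1ℚ)) ⟩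
    s * weight j (suc k) * lagShift n j k (X + ι j + 1ℚ) ∎
    where
    s = Y - 1ℚ + ι j
    X+ι[1+j]≡X+ι[j]+1 : X + ι (suc j) ≡ X + ι j + 1ℚ
    X+ι[1+j]≡X+ι[j]+1 = trans (cong (X +_) (ι-suc j)) (regroup X (ι j))
      where
      regroup : ∀ X j → X + (1ℚ + j) ≡ X + j + 1ℚ
      regroup = solve-∀ ℚ-ring
    cancel : ∀ G s g W → (G + s * g - G) * W ≡ s * g * W
    cancel = solve-∀ ℚ-ring

  term-recurrence : ∀ n k j →
    term (suc (suc n)) (suc k) j
      ≡ (term (suc n) k j + (defect n k j - defect n k (suc j)))
        + bcoef X Y (suc n) * term (suc n) (suc k) j - λcoef X Y (suc n) * term n (suc k) j
  term-recurrence n k j = begin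
    g₁ * lagShift (suc (suc n)) j (suc k) a
      ≡⟨ cong (g₁ *_) (lagShift-recurrence n j k) ⟩
    g₁ * (A₆ + b * A₃ - l * A₅ - s * A₄)
      ≡⟨ rearrange g₁ g₀ A₆ A₃ A₅ A₄ b l s ⟩
    (g₀ * A₆ + ((g₁ - g₀) * A₆ - s * g₁ * A₄)) + b * (g₁ * A₃) - l * (g₁ * A₅)
      ≡⟨ cong (λ d → (g₀ * A₆ + ((g₁ - g₀) * A₆ - d)) + b * (g₁ * A₃) - l * (g₁ * A₅)) (defect-suc n k j) ⟨
    (term (suc n) k j + (defect n k j - defect n k (suc j))) + b * term (suc n) (suc k) j - l * term n (suc k) j ∎
    where
    a  = X + ι j
    b  = bcoef X Y (suc n)
    l  = λcoef X Y (suc n)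
    s  = Y - 1ℚ + ι j
    g₀ = weight j k
    g₁ = weight j (suc k)
    A₃ = lagShift (suc n) j (suc k) a
    A₄ = lagShift n j k (a + 1ℚ)
    A₅ = lagShift n j (suc k) a
    A₆ = lagShift (suc n) j k a
    rearrange : ∀ g₁ g₀ A₆ A₃ A₅ A₄ b l s →
      g₁ * (A₆ + b * A₃ - l * A₅ - s * A₄)
        ≡ (g₀ * A₆ + ((g₁ - g₀) * A₆ - s * g₁ * A₄)) + b * (g₁ * A₃) - l * (g₁ * A₅)
    rearrange = solve-∀ ℚ-ring

  coeff-recurrence-suc : ∀ n k →
    coeff (suc (suc n)) (suc k)
      ≡ coeff (suc n) k + bcoef X Y (suc n) * coeff (suc n) (suc k) - λcoef X Y (suc n) * coeff n (suc k)
  coeff-recurrence-suc n k = begin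
    Σ0to N (term N (suc k))
      ≡⟨ Σ0to-cong N (λ j _ → term-recurrence n k j) ⟩
    Σ0to N (λ j → (term (suc n) k j + Δ j) + b * term (suc n) (suc k) j - l * term n (suc k) j)
      ≡⟨ Σ0to-linear N b l _ (term (suc n) (suc k)) (term n (suc k)) ⟩
    Σ0to N (λ j → term (suc n) k j + Δ j) + b * S (suc n) (suc k) - l * S n (suc k)
      ≡⟨ cong (λ t → t + b * S (suc n) (suc k) - l * S n (suc k))
              (trans (Σ0to-+ N (term (suc n) k) Δ) (cong (S (suc n) k +_) telescopes)) ⟩
    S (suc n) k + 0ℚ + b * S (suc n) (suc k) - l * S n (suc k)
      ≡⟨ cong₂ (λ p q → p + 0ℚ + b * q - l * S n (suc k))
               (coeff-extend k (ℕ.n≤1+n (suc n))) (coeff-extend (suc k) (ℕ.n≤1+n (suc n))) ⟩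
    coeff (suc n) k + 0ℚ + b * coeff (suc n) (suc k) - l * S n (suc k)
      ≡⟨ cong₂ (λ p q → p + b * coeff (suc n) (suc k) - l * q)
               (+-identityʳ (coeff (suc n) k)) (coeff-extend (suc k) (ℕ.m≤n+m n 2)) ⟩
    coeff (suc n) k + b * coeff (suc n) (suc k) - l * coeff n (suc k) ∎
    where
    N = suc (suc n)
    b = bcoef X Y (suc n)
    l = λcoef X Y (suc n)
    S : ℕ → ℕ → ℚ
    S m k = Σ0to N (term m k)
    Δ : ℕ → ℚ
    Δ j = defect n k j - defect n k (suc j)
    boundary : defect n k (suc N) ≡ 0ℚ
    boundary = trans (defect-suc n k N)
      (trans (cong (c *_) (lagShift-vanish n N k (X + ι N + 1ℚ) (ℕ.≤-trans (ℕ.n≤1+n (suc n)) (ℕ.m≤m+n N k)))) (*-zeroʳ c))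
      where c = (Y - 1ℚ + ι N) * weight N (suc k)
    telescopes : Σ0to N Δ ≡ 0ℚ
    telescopes = trans (Σ0to-telescope N (defect n k)) (trans (cong₂ _-_ (defect-zero n k) boundary) (+-inverseʳ 0ℚ))

  coeff-recurrence-zero : ∀ n →
    coeff (suc (suc n)) 0 ≡ bcoef X Y (suc n) * coeff (suc n) 0 - λcoef X Y (suc n) * coeff n 0
  coeff-recurrence-zero n = begin
    coeff (suc (suc n)) 0                               ≡⟨ coeff-zero (suc (suc n)) ⟩
    poch X n * (X + ι n) * (X + ι (suc n))              ≡⟨ cong (λ i → poch X n * (X + ι n) * (X + i)) (ι-suc n) ⟩
    poch X n * (X + ι n) * (X + (1ℚ + ι n))             ≡⟨ identity X Y (ι n) (poch X n) ⟩
    (X + ι n + (Y + ι n) + 1ℚ) * (poch X n * (X + ι n)) - (X + ι n) * (Y + ι n) * poch X n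
      ≡⟨ cong₂ (λ b l → b * (poch X n * (X + ι n)) - l * poch X n) (sym (bcoef-suc n)) (sym (λcoef-suc n)) ⟩
    bcoef X Y (suc n) * poch X (suc n) - λcoef X Y (suc n) * poch X n
      ≡⟨ cong₂ (λ p q → bcoef X Y (suc n) * p - λcoef X Y (suc n) * q) (sym (coeff-zero (suc n))) (sym (coeff-zero n)) ⟩
    bcoef X Y (suc n) * coeff (suc n) 0 - λcoef X Y (suc n) * coeff n 0 ∎
    where
    identity : ∀ X Y n p → p * (X + n) * (X + (1ℚ + n)) ≡ (X + n + (Y + n) + 1ℚ) * (p * (X + n)) - (X + n) * (Y + n) * p
    identity = solve-∀ ℚ-ring

  coeff-recurrence : ∀ n k →
    coeff (suc (suc n)) k
      ≡ shift (coeff (suc n)) k + bcoef X Y (suc n) * coeff (suc n) k - λcoef X Y (suc n) * coeff n k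
  coeff-recurrence n zero    =
    trans (coeff-recurrence-zero n)
          (cong (_- λcoef X Y (suc n) * coeff n 0) (sym (+-identityˡ (bcoef X Y (suc n) * coeff (suc n) 0))))
  coeff-recurrence n (suc k) = coeff-recurrence-suc n k

  L2≡[-1]^n*poly : ∀ n x → L2 n x X Y ≡ (- 1ℚ) ^ n * poly n (coeff n) (- x)
  L2≡[-1]^n*poly zero          x = refl
  L2≡[-1]^n*poly (suc zero)    x = begin
    (x - X) * 1ℚ - λcoef X Y 0 * 0ℚ                                ≡⟨ identity x X (λcoef X Y 0) ⟩
    (- 1ℚ * 1ℚ) * (1ℚ * (X + 0ℚ) * 1ℚ + 1ℚ * (- x * 1ℚ))
      ≡⟨ cong₂ (λ p q → (- 1ℚ * 1ℚ) * (p * 1ℚ + q * (- x * 1ℚ))) (coeff-zero 1) (coeff-diag 1) ⟨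
    (- 1ℚ) ^ 1 * poly 1 (coeff 1) (- x)                             ∎
    where
    identity : ∀ x X l → (x - X) * 1ℚ - l * 0ℚ ≡ (- 1ℚ * 1ℚ) * (1ℚ * (X + 0ℚ) * 1ℚ + 1ℚ * (- x * 1ℚ))
    identity = solve-∀ ℚ-ring
  L2≡[-1]^n*poly (suc (suc n)) x = begin
    (x - b) * L2 (suc n) x X Y - l * L2 n x X Y
      ≡⟨ cong₂ (λ p q → (x - b) * p - l * q) (L2≡[-1]^n*poly (suc n) x) (L2≡[-1]^n*poly n x) ⟩
    (x - b) * ((- 1ℚ) * (- 1ℚ) ^ n * P₁) - l * ((- 1ℚ) ^ n * P₀)
      ≡⟨ signs x b l ((- 1ℚ) ^ n) P₁ P₀ ⟩
    (- 1ℚ) * ((- 1ℚ) * (- 1ℚ) ^ n) * ((- x + b) * P₁ - l * P₀)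
      ≡⟨ cong ((- 1ℚ) * ((- 1ℚ) * (- 1ℚ) ^ n) *_)
              (sym (poly-three-term n b l (- x) (coeff-vanish n) (coeff-vanish (suc n)) (coeff-recurrence n))) ⟩
    (- 1ℚ) ^ suc (suc n) * poly (suc (suc n)) (coeff (suc (suc n))) (- x) ∎
    where
    b  = bcoef X Y (suc n)
    l  = λcoef X Y (suc n)
    P₁ = poly (suc n) (coeff (suc n)) (- x)
    P₀ = poly n (coeff n) (- x)
    signs : ∀ x b l s P₁ P₀ →
      (x - b) * ((- 1ℚ) * s * P₁) - l * (s * P₀) ≡ (- 1ℚ) * ((- 1ℚ) * s) * ((- x + b) * P₁ - l * P₀)
    signs = solve-∀ ℚ-ring

  F32-summand : ℕ → ℕ → ℕ → ℚ
  F32-summand n k j = poch (ι k - ι n) j * poch (ι k) j * poch (Y - 1ℚ) j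
                  * inv (poch (- ι n) j * poch (X + ι k) j * ι (j !)) * (1ℚ ^ j)

  F32-denominator≢0 : ∀ {n} k j r → k ℕ.+ j ℕ.+ r ≡ n → (∀ i → i < n → X + ι i ≢ 0ℚ) →
    poch (- ι n) j * poch (X + ι k) j * ι (j !) ≢ 0ℚ
  F32-denominator≢0 k j r refl X+i≢0 =
    *-≢0 (*-≢0 (poch[-n]≢0 j (ℕ.≤-trans (ℕ.m≤n+m j k) (ℕ.m≤m+n (k ℕ.+ j) r))) X+k+i≢0)
         (ι-≢0 (ℕ.≢-nonZero⁻¹ (j !) {{ℕ._!≢0 j}}))
    where
    X+k+i≢0 : poch (X + ι k) j ≢ 0ℚ
    X+k+i≢0 = poch-≢0 (X + ι k) j (λ i i<j X+k+i≡0 →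
      X+i≢0 (k ℕ.+ i) (ℕ.<-≤-trans (ℕ.+-monoʳ-< k i<j) (ℕ.m≤m+n (k ℕ.+ j) r))
            (trans (cong (X +_) (ι-+ k i)) (trans (sym (+-assoc X (ι k) (ι i))) X+k+i≡0)))

  prefactor*F32-summand≡term : ∀ {n} k j r → k ℕ.+ j ℕ.+ r ≡ n → (∀ i → i < n → X + ι i ≢ 0ℚ) →
    poch (X + ι k) (n ∸ k) * ι (n C k) * F32-summand n k j ≡ term n k j
  prefactor*F32-summand≡term {n} k j r refl X+i≢0 = begin
    poch (X + ι k) (n ∸ k) * Cₙ * (Pₐ * poch (ι k) j * Pᵧ * inv D * 1ℚ ^ j)
      ≡⟨ cong₂ (λ p q → p * Cₙ * (Pₐ * q * Pᵧ * inv D * 1ℚ ^ j)) prefactor-split (poch-ι k j) ⟩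
    Pₓ * Pₓᵣ * Cₙ * (Pₐ * ι (multichoose k j ℕ.* j !) * Pᵧ * inv D * 1ℚ ^ j)
      ≡⟨ cong₂ (λ p q → Pₓ * Pₓᵣ * Cₙ * (Pₐ * p * Pᵧ * inv D * q)) (ι-* (multichoose k j) (j !)) (1^j≡1 j) ⟩
    Pₓ * Pₓᵣ * Cₙ * (Pₐ * (G * F) * Pᵧ * inv D * 1ℚ)
      ≡⟨ regroup₁ Pₓ Pₓᵣ Cₙ Pₐ G F Pᵧ (inv D) ⟩
    Cₙ * Pₐ * (Pₓ * F * inv D * (G * Pᵧ * Pₓᵣ))
      ≡⟨ cong (_* (Pₓ * F * inv D * (G * Pᵧ * Pₓᵣ))) (ι[nCk]*poch[k-n]≡ι[[k+r]Ck]*poch[-n] k j r refl) ⟩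
    Cᵣ * Pₙ * (Pₓ * F * inv D * (G * Pᵧ * Pₓᵣ))
      ≡⟨ regroup₂ Cᵣ Pₙ Pₓ F (inv D) G Pᵧ Pₓᵣ ⟩
    D * (G * Pᵧ * (Cᵣ * Pₓᵣ)) * inv D
      ≡⟨ *-inv-cancel (G * Pᵧ * (Cᵣ * Pₓᵣ)) (F32-denominator≢0 k j r refl X+i≢0) ⟩
    G * Pᵧ * (Cᵣ * Pₓᵣ)
      ≡⟨ cong (λ a → G * Pᵧ * (Cᵣ * poch a r)) (swap X (ι k) (ι j)) ⟩
    G * Pᵧ * (Cᵣ * poch (X + ι j + ι k) r)
      ≡⟨ cong (G * Pᵧ *_) (lagShift-+ k j r (X + ι j)) ⟨
    term n k j ∎
    where
    Cₙ  = ι (n C k)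
    Cᵣ  = ι ((k ℕ.+ r) C k)
    Pₐ  = poch (ι k - ι n) j
    Pₙ  = poch (- ι n) j
    Pₓ  = poch (X + ι k) j
    Pₓᵣ = poch (X + ι k + ι j) r
    Pᵧ  = poch (Y - 1ℚ) j
    G   = ι (multichoose k j)
    F   = ι (j !)
    D   = Pₙ * Pₓ * F
    prefactor-split : poch (X + ι k) (n ∸ k) ≡ Pₓ * Pₓᵣ
    prefactor-split = trans (cong (poch (X + ι k)) (trans (cong (_∸ k) (ℕ.+-assoc k j r)) (ℕ.m+n∸m≡n k (j ℕ.+ r))))
                            (poch-+ (X + ι k) j r)
    swap : ∀ X k j → X + k + j ≡ X + j + k
    swap = solve-∀ ℚ-ring
    regroup₁ : ∀ Pₓ Pₓᵣ Cₙ Pₐ G F Pᵧ I →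
      Pₓ * Pₓᵣ * Cₙ * (Pₐ * (G * F) * Pᵧ * I * 1ℚ) ≡ Cₙ * Pₐ * (Pₓ * F * I * (G * Pᵧ * Pₓᵣ))
    regroup₁ = solve-∀ ℚ-ring
    regroup₂ : ∀ Cᵣ Pₙ Pₓ F I G Pᵧ Pₓᵣ →
      Cᵣ * Pₙ * (Pₓ * F * I * (G * Pᵧ * Pₓᵣ)) ≡ Pₙ * Pₓ * F * (G * Pᵧ * (Cᵣ * Pₓᵣ)) * I
    regroup₂ = solve-∀ ℚ-ring

  prefactor*F32≡coeff : ∀ n k → k ≤ n → (∀ i → i < n → X + ι i ≢ 0ℚ) →
    poch (X + ι k) (n ∸ k) * ι (n C k) * F32 (ι k - ι n) (ι k) (Y - 1ℚ) (- ι n) (X + ι k) 1ℚ (n ∸ k) ≡ coeff n k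
  prefactor*F32≡coeff n k k≤n X+i≢0 = begin
    c * Σ0to (n ∸ k) (F32-summand n k)            ≡⟨ Σ0to-*ˡ (n ∸ k) c (F32-summand n k) ⟨
    Σ0to (n ∸ k) (λ j → c * F32-summand n k j)
      ≡⟨ Σ0to-cong (n ∸ k) (λ j j≤n∸k → prefactor*F32-summand≡term k j (n ∸ k ∸ j) (split j j≤n∸k) X+i≢0) ⟩
    Σ0to (n ∸ k) (term n k)
      ≡⟨ Σ0to-extend (term n k) (ℕ.m∸n≤m n k) (λ j n∸k<j → term-vanish n k j (n<j+k j n∸k<j)) ⟨
    coeff n k                                 ∎
    where
    c = poch (X + ι k) (n ∸ k) * ι (n C k)
    split : ∀ j → j ≤ n ∸ k → k ℕ.+ j ℕ.+ (n ∸ k ∸ j) ≡ n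
    split j j≤n∸k = trans (ℕ.+-assoc k j _) (trans (cong (k ℕ.+_) (ℕ.m+[n∸m]≡n j≤n∸k)) (ℕ.m+[n∸m]≡n k≤n))
    n<j+k : ∀ j → n ∸ k < j → n < j ℕ.+ k
    n<j+k j n∸k<j = subst (ℕ._< j ℕ.+ k) (ℕ.m∸n+n≡m k≤n) (ℕ.+-monoˡ-< k n∸k<j)

theorem2p4 : (n : ℕ) (x X Y : ℚ) → (∀ m → m < n → X + ι m ≢ 0ℚ) →
    L2 n x X Y ≡ RHS n x X Y
theorem2p4 n x X Y X+m≢0 = begin
  L2 n x X Y                                                   ≡⟨ L2≡[-1]^n*poly X Y n x ⟩
  (- 1ℚ) ^ n * poly n (coeff X Y n) (- x)
    ≡⟨ Σ0to-*ˡ n ((- 1ℚ) ^ n) (λ k → coeff X Y n k * (- x) ^ k) ⟨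
  Σ0to n (λ k → (- 1ℚ) ^ n * (coeff X Y n k * (- x) ^ k))      ≡⟨ Σ0to-cong n monomial ⟨
  RHS n x X Y                                                  ∎
  where
  monomial : ∀ k → k ≤ n →
    poch (X + ι k) (n ∸ k) * ι (n C k) * F32 (ι k - ι n) (ι k) (Y - 1ℚ) (- ι n) (X + ι k) 1ℚ (n ∸ k)
      * (- 1ℚ) ^ (n ∸ k) * x ^ k ≡ (- 1ℚ) ^ n * (coeff X Y n k * (- x) ^ k)
  monomial k k≤n = begin
    _
      ≡⟨ cong (λ c → c * (- 1ℚ) ^ (n ∸ k) * x ^ k) (prefactor*F32≡coeff X Y n k k≤n X+m≢0) ⟩
    coeff X Y n k * (- 1ℚ) ^ (n ∸ k) * x ^ k     ≡⟨ *-assoc (coeff X Y n k) _ _ ⟩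
    coeff X Y n k * ((- 1ℚ) ^ (n ∸ k) * x ^ k)   ≡⟨ cong (coeff X Y n k *_) ([-1]^n*[-x]^k≡[-1]^[n∸k]*x^k x k≤n) ⟨
    coeff X Y n k * ((- 1ℚ) ^ n * (- x) ^ k)     ≡⟨ swap (coeff X Y n k) ((- 1ℚ) ^ n) ((- x) ^ k) ⟩
    (- 1ℚ) ^ n * (coeff X Y n k * (- x) ^ k)     ∎
    where
    swap : ∀ a b c → a * (b * c) ≡ b * (a * c)
    swap = solve-∀ ℚ-ring
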